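{- Let $n \ge 1$ and let $k$ be a positive integer. The number of pairs $(T,v)$ with $T \in \mathcal{T}_n$ and $v$ a vertex of $T$ of degree $k$ at odd level equals the number of pairs $(T,v)$ with $T \in \mathcal{T}_n$ and $v$ a vertex of $T$ of degree $k$ at even level.
   Context: $\mathcal{T}_n$ denotes the set of rooted ordered (plane) trees with $n$ edges. The degree of a vertex is the number of edges incident to it. The level of a vertex is its distance (number of edges) from the root (the root has level $0$). -}

module Defs where

open import Data.Nat using (ℕ; zero; suc; _+_)
open import Data.List using (List; []; _∷_; length)
open import Data.Bool using (Bool; true; false; not)
open import Data.Product using (Σ; _×_)
open import Relation.Binary.PropositionalEquality using (_≡_)

-- Rooted ordered (plane) trees: a vertex with an ordered list of subtrees.
data Tree : Set where
  node : List Tree → Tree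

mutual
  edges : Tree → ℕ
  edges (node ts) = edgesF ts

  edgesF : List Tree → ℕ
  edgesF []       = 0
  edgesF (t ∷ ts) = suc (edges t) + edgesF ts

-- A vertex of a tree, identified by its position (path from the root).
mutual
  data Vertex : Tree → Set where
    here  : ∀ {ts} → Vertex (node ts)
    below : ∀ {ts} → VertexF ts → Vertex (node ts)

  data VertexF : List Tree → Set where
    inHead : ∀ {t ts} → Vertex t → VertexF (t ∷ ts)
    inTail : ∀ {t ts} → VertexF ts → VertexF (t ∷ ts)

mutual
  children : {t : Tree} → Vertex t → ℕ
  children {node ts} here      = length ts
  children (below p)           = childrenF p

  childrenF : {ts : List Tree} → VertexF ts → ℕ
  childrenF (inHead v) = children v
  childrenF (inTail p) = childrenF p

mutual
  level : {t : Tree} → Vertex t → ℕ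
  level here      = 0
  level (below p) = suc (levelF p)

  levelF : {ts : List Tree} → VertexF ts → ℕ
  levelF (inHead v) = level v
  levelF (inTail p) = levelF p

-- degree = number of incident edges: children, plus the edge to the parent
-- for non-root vertices
degree : {t : Tree} → Vertex t → ℕ
degree {node ts} here = length ts
degree (below p) = suc (childrenF p)

isOdd : ℕ → Bool
isOdd zero    = false
isOdd (suc n) = not (isOdd n)

Pairs : (n k : ℕ) → (b : Bool) → Set
Pairs n k b = Σ Tree (λ T → edges T ≡ n × Σ (Vertex T) (λ v → degree v ≡ k × isOdd (level v) ≡ b))

-- A vertex v of positive degree is moved one level up or down, keeping its own children,
-- so that its degree and the number of edges are unchanged. If v has a left sibling w, v
-- becomes the first child of w; if v is the first child of a non-root vertex u, it is
-- moved to the position right after u; the root and its first child swap roles, the old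
-- vertex keeping its remaining children. These moves are mutually inverse, so they form an
-- involution on the pairs (T , v) with deg v ≥ 1 that flips the parity of the level.
-- On zippers (a focused subtree together with the crumbs leading back to the root) each
-- move is a single local rewrite.
module Submission where

open import Defs
open import Data.Nat using (ℕ; suc; _+_; _≥_)
open import Data.Nat.Properties using (+-identityʳ; +-suc)
import Data.Nat.Properties as ℕ
open import Data.Nat.Tactic.RingSolver using (solve-∀)
open import Data.Bool using (Bool; true; false; not)
open import Data.Bool.Properties using (not-involutive)
import Data.Bool.Properties as 𝔹
open import Data.List using (List; []; _∷_; length; _++_; _ʳ++_)
open import Data.List.Properties using (++-identityʳ)
open import Data.Product using (Σ; _×_; _,_; proj₁; proj₂)
open import Function.Base using (_∘_)
open import Function.Bundles using (_↔_; mk↔ₛ′)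
open import Axiom.UniquenessOfIdentityProofs using (module Decidable⇒UIP)
open import Relation.Binary.PropositionalEquality
  using (_≡_; refl; sym; trans; cong; module ≡-Reasoning)

Pointed : Set
Pointed = Σ Tree Vertex

-- A crumb holds the left siblings of a subtree, nearest first, and its right siblings.
Crumb : Set
Crumb = List Tree × List Tree

-- The crumbs are listed from the focus up to the root; the focus is given by its children.
Zipper : Set
Zipper = List Crumb × List Tree

skipLeft : {ts : List Tree} (L : List Tree) → VertexF ts → VertexF (L ʳ++ ts)
skipLeft []      p = p
skipLeft (_ ∷ L) p = skipLeft L (inTail p)

plugAt : (t : Tree) → Vertex t → List Crumb → Pointed
plugAt t v []             = t , v
plugAt t v ((L , R) ∷ cs) = plugAt (node (L ʳ++ t ∷ R)) (below (skipLeft L (inHead v))) cs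

plug : Zipper → Pointed
plug (cs , ts) = plugAt (node ts) here cs

mutual
  unzipAt : {t : Tree} → Vertex t → List Crumb → Zipper
  unzipAt {node ts} here      cs = cs , ts
  unzipAt           (below p) cs = unzipAtF p [] cs

  unzipAtF : {ts : List Tree} → VertexF ts → List Tree → List Crumb → Zipper
  unzipAtF {_ ∷ R} (inHead v) L cs = unzipAt v ((L , R) ∷ cs)
  unzipAtF {t ∷ _} (inTail p) L cs = unzipAtF p (t ∷ L) cs

unzip : Pointed → Zipper
unzip (_ , v) = unzipAt v []

unzipAtF-skipLeft : {ts : List Tree} (L : List Tree) (p : VertexF ts) (L′ : List Tree) (cs : List Crumb) →
                    unzipAtF (skipLeft L p) L′ cs ≡ unzipAtF p (L ++ L′) cs
unzipAtF-skipLeft []      p L′ cs = refl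
unzipAtF-skipLeft (_ ∷ L) p L′ cs = unzipAtF-skipLeft L (inTail p) L′ cs

unzip-plugAt : (t : Tree) (v : Vertex t) (cs : List Crumb) → unzip (plugAt t v cs) ≡ unzipAt v cs
unzip-plugAt t v []             = refl
unzip-plugAt t v ((L , R) ∷ cs) = begin
  unzip (plugAt _ _ cs)                          ≡⟨ unzip-plugAt _ _ cs ⟩
  unzipAtF (skipLeft L (inHead v)) [] cs         ≡⟨ unzipAtF-skipLeft L (inHead v) [] cs ⟩
  unzipAt v ((L ++ [] , R) ∷ cs)                 ≡⟨ cong (λ M → unzipAt v ((M , R) ∷ cs)) (++-identityʳ L) ⟩
  unzipAt v ((L , R) ∷ cs)                       ∎
  where open ≡-Reasoning

unzip-plug : (z : Zipper) → unzip (plug z) ≡ z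
unzip-plug (cs , ts) = unzip-plugAt (node ts) here cs

mutual
  plug-unzipAt : {t : Tree} (v : Vertex t) (cs : List Crumb) → plug (unzipAt v cs) ≡ plugAt t v cs
  plug-unzipAt {node ts} here      cs = refl
  plug-unzipAt           (below p) cs = plug-unzipAtF p [] cs

  plug-unzipAtF : {ts : List Tree} (p : VertexF ts) (L : List Tree) (cs : List Crumb) →
                  plug (unzipAtF p L cs) ≡ plugAt (node (L ʳ++ ts)) (below (skipLeft L p)) cs
  plug-unzipAtF {_ ∷ R} (inHead v) L cs = plug-unzipAt v ((L , R) ∷ cs)
  plug-unzipAtF {t ∷ _} (inTail p) L cs = plug-unzipAtF p (t ∷ L) cs

plug-unzip : (x : Pointed) → plug (unzip x) ≡ x
plug-unzip (_ , v) = plug-unzipAt v []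

rotate : Zipper → Zipper
rotate ([] , [])                       = [] , []
rotate ([] , node R ∷ ts)              = ([] , R) ∷ [] , ts
rotate (([] , R) ∷ [] , ts)            = [] , node R ∷ ts
rotate (([] , R) ∷ (L , R′) ∷ cs , ts) = (node R ∷ L , R′) ∷ cs , ts
rotate ((node R ∷ L , R′) ∷ cs , ts)   = ([] , R) ∷ (L , R′) ∷ cs , ts

rotate-involutive : (z : Zipper) → rotate (rotate z) ≡ z
rotate-involutive ([] , [])                       = refl
rotate-involutive ([] , node R ∷ ts)              = refl
rotate-involutive (([] , R) ∷ [] , ts)            = refl
rotate-involutive (([] , R) ∷ (L , R′) ∷ cs , ts) = refl
rotate-involutive ((node R ∷ L , R′) ∷ cs , ts)   = refl

crumbEdges : List Crumb → ℕ
crumbEdges []             = 0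
crumbEdges ((L , R) ∷ cs) = suc (edgesF L + edgesF R) + crumbEdges cs

size : Zipper → ℕ
size (cs , ts) = edgesF ts + crumbEdges cs

focusDegree : Zipper → ℕ
focusDegree ([]    , ts) = length ts
focusDegree (_ ∷ _ , ts) = suc (length ts)

depth : Zipper → ℕ
depth (cs , _) = length cs

size-rotate : (z : Zipper) → size (rotate z) ≡ size z
size-rotate ([] , []) = refl
size-rotate ([] , node R ∷ ts) = lemma (edgesF R) (edgesF ts)
  where
  lemma : ∀ r t → t + (suc (0 + r) + 0) ≡ suc r + t + 0
  lemma = solve-∀
size-rotate (([] , R) ∷ [] , ts) = lemma (edgesF R) (edgesF ts)
  where
  lemma : ∀ r t → suc r + t + 0 ≡ t + (suc (0 + r) + 0)
  lemma = solve-∀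
size-rotate (([] , R) ∷ (L , R′) ∷ cs , ts) =
  lemma (edgesF R) (edgesF L) (edgesF R′) (crumbEdges cs) (edgesF ts)
  where
  lemma : ∀ r l r′ c t → t + (suc (suc r + l + r′) + c) ≡ t + (suc (0 + r) + (suc (l + r′) + c))
  lemma = solve-∀
size-rotate ((node R ∷ L , R′) ∷ cs , ts) =
  lemma (edgesF R) (edgesF L) (edgesF R′) (crumbEdges cs) (edgesF ts)
  where
  lemma : ∀ r l r′ c t → t + (suc (0 + r) + (suc (l + r′) + c)) ≡ t + (suc (suc r + l + r′) + c)
  lemma = solve-∀

focusDegree-rotate : (z : Zipper) → focusDegree (rotate z) ≡ focusDegree z
focusDegree-rotate ([] , [])                       = refl
focusDegree-rotate ([] , node R ∷ ts)              = refl
focusDegree-rotate (([] , R) ∷ [] , ts)            = refl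
focusDegree-rotate (([] , R) ∷ (L , R′) ∷ cs , ts) = refl
focusDegree-rotate ((node R ∷ L , R′) ∷ cs , ts)   = refl

-- The single-vertex tree is the fixed point of rotate; positive degree excludes it.
isOdd-depth-rotate : (z : Zipper) {k : ℕ} → focusDegree z ≡ suc k →
                     isOdd (depth (rotate z)) ≡ not (isOdd (depth z))
isOdd-depth-rotate ([] , node R ∷ ts)              _ = refl
isOdd-depth-rotate (([] , R) ∷ [] , ts)            _ = refl
isOdd-depth-rotate (([] , R) ∷ (L , R′) ∷ cs , ts) _ = sym (not-involutive _)
isOdd-depth-rotate ((node R ∷ L , R′) ∷ cs , ts)   _ = refl

edgesF-ʳ++ : (L ts : List Tree) → edgesF (L ʳ++ ts) ≡ edgesF L + edgesF ts
edgesF-ʳ++ []      ts = refl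
edgesF-ʳ++ (t ∷ L) ts = trans (edgesF-ʳ++ L (t ∷ ts)) (lemma (edgesF L) (edges t) (edgesF ts))
  where
  lemma : ∀ l e r → l + suc (e + r) ≡ suc (e + l) + r
  lemma = solve-∀

levelF-skipLeft : {ts : List Tree} (L : List Tree) (p : VertexF ts) → levelF (skipLeft L p) ≡ levelF p
levelF-skipLeft []      p = refl
levelF-skipLeft (_ ∷ L) p = levelF-skipLeft L (inTail p)

childrenF-skipLeft : {ts : List Tree} (L : List Tree) (p : VertexF ts) → childrenF (skipLeft L p) ≡ childrenF p
childrenF-skipLeft []      p = refl
childrenF-skipLeft (_ ∷ L) p = childrenF-skipLeft L (inTail p)

edges-plugAt : (t : Tree) (v : Vertex t) (cs : List Crumb) →
               edges (proj₁ (plugAt t v cs)) ≡ edges t + crumbEdges cs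
edges-plugAt t v []             = sym (+-identityʳ _)
edges-plugAt t v ((L , R) ∷ cs) = begin
  edges (proj₁ (plugAt _ _ cs))                  ≡⟨ edges-plugAt _ _ cs ⟩
  edgesF (L ʳ++ t ∷ R) + crumbEdges cs           ≡⟨ cong (_+ crumbEdges cs) (edgesF-ʳ++ L (t ∷ R)) ⟩
  edgesF L + suc (edges t + edgesF R) + crumbEdges cs
    ≡⟨ lemma (edgesF L) (edges t) (edgesF R) (crumbEdges cs) ⟩
  edges t + crumbEdges ((L , R) ∷ cs)            ∎
  where
  open ≡-Reasoning
  lemma : ∀ l e r c → l + suc (e + r) + c ≡ e + (suc (l + r) + c)
  lemma = solve-∀

level-plugAt : (t : Tree) (v : Vertex t) (cs : List Crumb) →
               level (proj₂ (plugAt t v cs)) ≡ level v + length cs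
level-plugAt t v []             = sym (+-identityʳ _)
level-plugAt t v ((L , R) ∷ cs) = begin
  level (proj₂ (plugAt _ _ cs))                        ≡⟨ level-plugAt _ _ cs ⟩
  suc (levelF (skipLeft L (inHead v))) + length cs     ≡⟨ cong (λ m → suc m + length cs) (levelF-skipLeft L (inHead v)) ⟩
  suc (level v) + length cs                            ≡⟨ sym (+-suc (level v) (length cs)) ⟩
  level v + length ((L , R) ∷ cs)                      ∎
  where open ≡-Reasoning

degree-plugAt-below : {ts : List Tree} (p : VertexF ts) (cs : List Crumb) →
                      degree (proj₂ (plugAt (node ts) (below p) cs)) ≡ suc (childrenF p)
degree-plugAt-below p []             = refl
degree-plugAt-below p ((L , R) ∷ cs) =
  trans (degree-plugAt-below (skipLeft L (inHead (below p))) cs)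
        (cong suc (childrenF-skipLeft L (inHead (below p))))

edges-plug : (z : Zipper) → edges (proj₁ (plug z)) ≡ size z
edges-plug (cs , ts) = edges-plugAt (node ts) here cs

level-plug : (z : Zipper) → level (proj₂ (plug z)) ≡ depth z
level-plug (cs , ts) = level-plugAt (node ts) here cs

degree-plug : (z : Zipper) → degree (proj₂ (plug z)) ≡ focusDegree z
degree-plug ([]             , ts) = refl
degree-plug (((L , R) ∷ cs) , ts) =
  trans (degree-plugAt-below (skipLeft L (inHead here)) cs)
        (cong suc (childrenF-skipLeft L (inHead {t = node ts} here)))

statistic-unzip : {A : Set} (s : Pointed → A) (f : Zipper → A) →
                  (∀ z → s (plug z) ≡ f z) → ∀ x → s x ≡ f (unzip x)
statistic-unzip s f s-plug x = trans (cong s (sym (plug-unzip x))) (s-plug (unzip x))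

shift : Pointed → Pointed
shift = plug ∘ rotate ∘ unzip

shift-involutive : (x : Pointed) → shift (shift x) ≡ x
shift-involutive x = begin
  plug (rotate (unzip (plug (rotate (unzip x)))))  ≡⟨ cong (plug ∘ rotate) (unzip-plug (rotate (unzip x))) ⟩
  plug (rotate (rotate (unzip x)))                 ≡⟨ cong plug (rotate-involutive (unzip x)) ⟩
  plug (unzip x)                                   ≡⟨ plug-unzip x ⟩
  x                                                ∎
  where open ≡-Reasoning

edges-shift : (x : Pointed) → edges (proj₁ (shift x)) ≡ edges (proj₁ x)
edges-shift x = begin
  edges (proj₁ (shift x))    ≡⟨ edges-plug (rotate (unzip x)) ⟩
  size (rotate (unzip x))   ≡⟨ size-rotate (unzip x) ⟩
  size (unzip x)            ≡⟨ sym (statistic-unzip (edges ∘ proj₁) size edges-plug x) ⟩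
  edges (proj₁ x)           ∎
  where open ≡-Reasoning

degree-shift : (x : Pointed) → degree (proj₂ (shift x)) ≡ degree (proj₂ x)
degree-shift x = begin
  degree (proj₂ (shift x))          ≡⟨ degree-plug (rotate (unzip x)) ⟩
  focusDegree (rotate (unzip x))   ≡⟨ focusDegree-rotate (unzip x) ⟩
  focusDegree (unzip x)            ≡⟨ sym (statistic-unzip (degree ∘ proj₂) focusDegree degree-plug x) ⟩
  degree (proj₂ x)                 ∎
  where open ≡-Reasoning

isOdd-level-shift : (x : Pointed) {k : ℕ} → degree (proj₂ x) ≡ suc k →
                   isOdd (level (proj₂ (shift x))) ≡ not (isOdd (level (proj₂ x)))
isOdd-level-shift x {k} deg≡ = begin
  isOdd (level (proj₂ (shift x)))    ≡⟨ cong isOdd (level-plug (rotate (unzip x))) ⟩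
  isOdd (depth (rotate (unzip x)))  ≡⟨ isOdd-depth-rotate (unzip x) focusDegree≡ ⟩
  not (isOdd (depth (unzip x)))     ≡⟨ cong (not ∘ isOdd) (sym (statistic-unzip (level ∘ proj₂) depth level-plug x)) ⟩
  not (isOdd (level (proj₂ x)))     ∎
  where
  open ≡-Reasoning
  focusDegree≡ : focusDegree (unzip x) ≡ suc k
  focusDegree≡ = trans (sym (statistic-unzip (degree ∘ proj₂) focusDegree degree-plug x)) deg≡

pointed : {n k : ℕ} {b : Bool} → Pairs n k b → Pointed
pointed (T , _ , v , _) = T , v

Pairs-≡ : {n k : ℕ} {b : Bool} {p q : Pairs n k b} → pointed p ≡ pointed q → p ≡ q
Pairs-≡ {p = _ , e , _ , d , o} {_ , e′ , _ , d′ , o′} refl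
  rewrite ℕ.≡-irrelevant e e′ | ℕ.≡-irrelevant d d′ | Decidable⇒UIP.≡-irrelevant 𝔹._≟_ o o′ = refl

shiftPairs : {n k : ℕ} {b : Bool} → Pairs n (suc k) b → Pairs n (suc k) (not b)
shiftPairs (T , e , v , d , o) =
  proj₁ (shift (T , v)) , trans (edges-shift (T , v)) e ,
  proj₂ (shift (T , v)) , trans (degree-shift (T , v)) d ,
  trans (isOdd-level-shift (T , v) d) (cong not o)

corollary2p4 : (n k : ℕ) → n ≥ 1 → k ≥ 1 → Pairs n k true ↔ Pairs n k false
corollary2p4 n (suc k) _ _ =
  mk↔ₛ′ shiftPairs shiftPairs
        (λ p → Pairs-≡ (shift-involutive (pointed p)))
        (λ p → Pairs-≡ (shift-involutive (pointed p)))
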